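{- Let $G$ be a finite abelian group of order $v$ and let $S \subseteq G$ be a $(v,k,\mu)$ sum set. Then $S$ is reversible, i.e. $S = S^{(-1)}$.
   Context: For $a \in G$, the number of ways to write $a$ as a product in $S$ is the number of ordered pairs $(x,y) \in S\times S$ with $xy = a$. $S$ with $|S|=k$ is a $(v,k,\mu)$ sum set if every nonidentity element of $G$ can be written as a product in $S$ in exactly $\mu$ ways. $S^{(-1)} = \{s^{ -1} : s \in S\}$. -}

module Defs where

open import Level using (0ℓ)
open import Algebra.Bundles using (AbelianGroup)
open import Data.Nat using (ℕ)
open import Data.Fin using (Fin)
open import Data.List using (List; length; filter; allFin; cartesianProduct)
open import Data.Product using (Σ; _×_; _,_; ∃)
open import Relation.Nullary using (¬_; Dec; _×-dec_)
open import Relation.Unary using (Pred)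
open import Relation.Binary.PropositionalEquality using (_≡_)
import Relation.Binary.Definitions as BD

record FiniteAbelianGroup (v : ℕ) : Set₁ where
  field
    abGroup : AbelianGroup 0ℓ 0ℓ
  open AbelianGroup abGroup public
  field
    _≟_     : BD.Decidable _≈_
    enum    : Fin v → Carrier
    enum-injective  : ∀ {i j} → enum i ≈ enum j → i ≡ j
    enum-surjective : ∀ x → ∃ λ i → enum i ≈ x

module _ {v : ℕ} (G : FiniteAbelianGroup v) where
  open FiniteAbelianGroup G

  record Subset : Set₁ where
    field
      _∈S      : Pred Carrier 0ℓ
      _∈S?     : ∀ x → Dec (x ∈S)
      respects : ∀ {x y} → x ≈ y → x ∈S → y ∈S

  open Subset public

  card : Subset → ℕ
  card S = length (filter (λ i → _∈S? S (enum i)) (allFin v))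

  reps : Subset → Carrier → ℕ
  reps S a = length (filter
    (λ p → let (i , j) = p in
       (_∈S? S (enum i) ×-dec _∈S? S (enum j)) ×-dec ((enum i ∙ enum j) ≟ a))
    (cartesianProduct (allFin v) (allFin v)))

  IsSumSet : Subset → ℕ → ℕ → Set
  IsSumSet S k μ = card S ≡ k × (∀ a → ¬ (a ≈ ε) → reps S a ≡ μ)

  Reversible : Subset → Set
  Reversible S = ∀ x → (_∈S S x → _∈S S (x ⁻¹)) × (_∈S S (x ⁻¹) → _∈S S x)

-- Let f be the indicator of S in the group ring ℤ[G], with convolution ⋆ and involution
-- F † = F ∘ _⁻¹.  Since (f ⋆ f)(a) counts the representations of a, the hypothesis says
-- f ⋆ f = μ 𝟏 + c δ with c = (f ⋆ f)(ε) − μ; hence (f ⋆ f)† = f ⋆ f = f† ⋆ f†, and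
-- X ⋆ f ⋆ f = c X whenever ∑ X = 0.  If moreover W = f ⋆ X is self-adjoint, then
-- ∑ W² = (W ⋆ W)(ε) = c (X ⋆ X)(ε), and the sign of c decides which X to use.
-- If c ≥ 0, take X = f − f†: then (X ⋆ X)(ε) = −∑ X² ≤ 0, so W = 0, and ∑ X² = −2 W(ε) = 0.
-- If c < 0, take X = |G| (f + f†) − 2|S| 𝟏, for which f ⋆ X = f† ⋆ X because
-- f ⋆ (f + f†) = f† ⋆ (f + f†): then (X ⋆ X)(ε) = ∑ X² ≥ 0, so X = 0, i.e. f(x) + f(x⁻¹) is
-- constant, which for a 0/1-valued f means f = f†.
module Submission where

open import Level using (0ℓ)
open import Algebra.Bundles using (AbelianGroup)
open import Algebra.Core using (Op₁; Op₂)
import Algebra.Structures as Structures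
open import Data.Bool.Base using (true; false; if_then_else_)
open import Data.Empty using (⊥-elim)
open import Data.Fin.Base using (Fin; zero; suc)
open import Data.Fin.Properties using (_≟_)
open import Data.Fin.Permutation using (permutation)
open import Data.Integer.Base using (ℤ; +_; -[1+_]; 0ℤ; 1ℤ; -_; _+_; _-_; _*_; ∣_∣)
import Data.Integer.Properties as ℤ
open import Data.Integer.Tactic.RingSolver using (solve-∀)
open import Data.List.Base using (List; _++_; map; length; filter; tabulate; cartesianProduct)
open import Data.List.Properties using (filter-++; length-++; map-tabulate)
open import Data.Nat.Base as ℕ using (ℕ)
import Data.Nat.Properties as ℕ
open import Data.Product.Base using (_×_; _,_; proj₁; proj₂)
open import Data.Sum.Base using (_⊎_; inj₁; inj₂)
open import Function.Base using (_∘_)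
open import Function.Bundles using (_⇔_; mk⇔)
open import Relation.Binary.PropositionalEquality using (_≡_; _≢_; _≗_; refl; sym; trans; cong; cong₂; isEquivalence; module ≡-Reasoning)
open import Relation.Nullary.Decidable using (Dec; yes; no; does; _because_; _×-dec_; does-⇔)
open import Relation.Nullary.Negation using (¬_)
open import Relation.Unary using (Pred; Decidable)
open import Relation.Binary.Bundles using (Setoid)

open import Algebra.Properties.Semiring.Sum ℤ.+-*-semiring
  using (sum; sum-syntax; sum-cong-≗; sum-replicate-zero; ∑-distrib-+; ∑-comm; ∑-permute; *-distribˡ-sum; *-distribʳ-sum)

open import Defs

open ≡-Reasoning

𝟙 : {A : Set} → Dec A → ℤ
𝟙 a? = if does a? then 1ℤ else 0ℤ

module _ {A B : Set} where

  𝟙-cong : A ⇔ B → (a? : Dec A) (b? : Dec B) → 𝟙 a? ≡ 𝟙 b?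
  𝟙-cong A⇔B a? b? = cong (λ b → if b then 1ℤ else 0ℤ) (does-⇔ A⇔B a? b?)

  𝟙-×-dec : (a? : Dec A) (b? : Dec B) → 𝟙 (a? ×-dec b?) ≡ 𝟙 a? * 𝟙 b?
  𝟙-×-dec (true because _) (true because _) = refl
  𝟙-×-dec (true because _) (false because _) = refl
  𝟙-×-dec (false because _) (true because _) = refl
  𝟙-×-dec (false because _) (false because _) = refl

  𝟙-≡⇒ : (a? : Dec A) (b? : Dec B) → 𝟙 a? ≡ 𝟙 b? → A → B
  𝟙-≡⇒ a? (yes b) _ _ = b
  𝟙-≡⇒ (yes _) (no _) () _
  𝟙-≡⇒ (no ¬a) (no _) _ a = ⊥-elim (¬a a)

  𝟙+𝟙≡𝟙+𝟙⇒≡ : {C : Set} (a? : Dec A) (b? : Dec B) (c? : Dec C) →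
              𝟙 a? + 𝟙 b? ≡ 𝟙 c? + 𝟙 c? → 𝟙 a? ≡ 𝟙 b?
  𝟙+𝟙≡𝟙+𝟙⇒≡ (true because _) (true because _) _ _ = refl
  𝟙+𝟙≡𝟙+𝟙⇒≡ (false because _) (false because _) _ _ = refl
  𝟙+𝟙≡𝟙+𝟙⇒≡ (true because _) (false because _) (true because _) ()
  𝟙+𝟙≡𝟙+𝟙⇒≡ (true because _) (false because _) (false because _) ()
  𝟙+𝟙≡𝟙+𝟙⇒≡ (false because _) (true because _) (true because _) ()
  𝟙+𝟙≡𝟙+𝟙⇒≡ (false because _) (true because _) (false because _) ()

-- Integer sums over Fin n

∑-neg : ∀ {n} (F : Fin n → ℤ) → ∑[ i < n ] (- F i) ≡ - sum F
∑-neg F = begin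
  ∑[ i < _ ] (- F i)        ≡⟨ sum-cong-≗ (λ i → sym (ℤ.-1*i≡-i (F i))) ⟩
  ∑[ i < _ ] (- 1ℤ * F i)   ≡⟨ sym (*-distribˡ-sum (- 1ℤ) F) ⟩
  - 1ℤ * sum F              ≡⟨ ℤ.-1*i≡-i (sum F) ⟩
  - sum F                   ∎

∑-distrib-- : ∀ {n} (F H : Fin n → ℤ) → ∑[ i < n ] (F i - H i) ≡ sum F - sum H
∑-distrib-- F H = trans (∑-distrib-+ F (-_ ∘ H)) (cong (λ s → sum F + s) (∑-neg H))

∑-const : ∀ n c → ∑[ i < n ] c ≡ + n * c
∑-const ℕ.zero c = sym (ℤ.*-zeroˡ c)
∑-const (ℕ.suc n) c = trans (cong (λ s → c + s) (∑-const n c)) (sym (ℤ.suc-* (+ n) c))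

∑-dirac : ∀ {n} (F : Fin n → ℤ) (b : Fin n) → ∑[ i < n ] (F i * 𝟙 (i ≟ b)) ≡ F b
∑-dirac {ℕ.suc n} F zero = begin
  F zero * 1ℤ + ∑[ i < n ] (F (suc i) * 0ℤ)  ≡⟨ cong₂ _+_ (ℤ.*-identityʳ (F zero)) (sum-cong-≗ (ℤ.*-zeroʳ ∘ F ∘ suc)) ⟩
  F zero + sum {n} (λ _ → 0ℤ)                ≡⟨ cong (λ s → F zero + s) (sum-replicate-zero n) ⟩
  F zero + 0ℤ                                ≡⟨ ℤ.+-identityʳ (F zero) ⟩
  F zero                                     ∎
∑-dirac {ℕ.suc n} F (suc b) = begin
  F zero * 0ℤ + ∑[ i < n ] (F (suc i) * 𝟙 (i ≟ b))  ≡⟨ cong₂ _+_ (ℤ.*-zeroʳ (F zero)) (∑-dirac (F ∘ suc) b) ⟩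
  0ℤ + F (suc b)                                    ≡⟨ ℤ.+-identityˡ (F (suc b)) ⟩
  F (suc b)                                         ∎

∑-reindex : ∀ {n} (F : Fin n → ℤ) (φ ψ : Fin n → Fin n) →
            (∀ i → φ (ψ i) ≡ i) → (∀ i → ψ (φ i) ≡ i) → sum F ≡ sum (F ∘ φ)
∑-reindex F φ ψ φψ ψφ = ∑-permute F (permutation φ ψ φψ ψφ)

‖_‖² : ∀ {n} → (Fin n → ℤ) → ℕ
‖_‖² {ℕ.zero} F = 0
‖_‖² {ℕ.suc n} F = ∣ F zero ∣ ℕ.* ∣ F zero ∣ ℕ.+ ‖ F ∘ suc ‖²

i*i≡+∣i∣*∣i∣ : ∀ i → i * i ≡ + (∣ i ∣ ℕ.* ∣ i ∣)
i*i≡+∣i∣*∣i∣ (+ ℕ.zero) = refl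
i*i≡+∣i∣*∣i∣ (+ ℕ.suc m) = refl
i*i≡+∣i∣*∣i∣ -[1+ m ] = refl

∑-sq≡‖‖² : ∀ {n} (F : Fin n → ℤ) → ∑[ i < n ] (F i * F i) ≡ + ‖ F ‖²
∑-sq≡‖‖² {ℕ.zero} F = refl
∑-sq≡‖‖² {ℕ.suc n} F =
  trans (cong₂ _+_ (i*i≡+∣i∣*∣i∣ (F zero)) (∑-sq≡‖‖² (F ∘ suc))) (sym (ℤ.pos-+ _ ‖ F ∘ suc ‖²))

‖‖²≡0⇒≡0 : ∀ {n} (F : Fin n → ℤ) → ‖ F ‖² ≡ 0 → ∀ i → F i ≡ 0ℤ
‖‖²≡0⇒≡0 F ‖F‖²≡0 zero with ℕ.m*n≡0⇒m≡0∨n≡0 ∣ F zero ∣ (ℕ.m+n≡0⇒m≡0 _ ‖F‖²≡0)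
... | inj₁ ∣F0∣≡0 = ℤ.∣i∣≡0⇒i≡0 ∣F0∣≡0
... | inj₂ ∣F0∣≡0 = ℤ.∣i∣≡0⇒i≡0 ∣F0∣≡0
‖‖²≡0⇒≡0 F ‖F‖²≡0 (suc i) = ‖‖²≡0⇒≡0 (F ∘ suc) (ℕ.m+n≡0⇒n≡0 (∣ F zero ∣ ℕ.* ∣ F zero ∣) ‖F‖²≡0) i

+m≡+n*-+k⇒m≡0 : ∀ m n k → + m ≡ + n * - + k → m ≡ 0
+m≡+n*-+k⇒m≡0 m ℕ.zero k eq = ℤ.+-injective eq
+m≡+n*-+k⇒m≡0 m (ℕ.suc n) ℕ.zero eq = ℤ.+-injective (trans eq (ℤ.*-zeroʳ (+ ℕ.suc n)))
+m≡+n*-+k⇒m≡0 m (ℕ.suc n) (ℕ.suc k) ()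

+m≡-[1+n]*+k⇒k≡0 : ∀ m n k → + m ≡ -[1+ n ] * + k → k ≡ 0
+m≡-[1+n]*+k⇒k≡0 m n ℕ.zero eq = refl
+m≡-[1+n]*+k⇒k≡0 m n (ℕ.suc k) ()

+n*-cancel : ∀ {n} → Fin n → ∀ i j → + n * i ≡ + n * j → i ≡ j
+n*-cancel {ℕ.suc n} _ i j = ℤ.*-cancelˡ-≡ (+ ℕ.suc n) i j

count-tabulate : ∀ {C : Set} {P : Pred C 0ℓ} (P? : Decidable P) {n} (t : Fin n → C) →
                 + length (filter P? (tabulate t)) ≡ ∑[ i < n ] 𝟙 (P? (t i))
count-tabulate P? {ℕ.zero} t = refl
count-tabulate P? {ℕ.suc n} t with P? (t zero)
... | yes _ = cong (λ s → 1ℤ + s) (count-tabulate P? (t ∘ suc))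
... | no _ = trans (count-tabulate P? (t ∘ suc)) (sym (ℤ.+-identityˡ _))

module _ {A B : Set} {P : Pred (A × B) 0ℓ} (P? : Decidable P) where

  count-cartesianProduct : ∀ {m n} (t : Fin m → A) (u : Fin n → B) →
    + length (filter P? (cartesianProduct (tabulate t) (tabulate u))) ≡ ∑[ i < m ] ∑[ j < n ] 𝟙 (P? (t i , u j))
  count-cartesianProduct {ℕ.zero} t u = refl
  count-cartesianProduct {ℕ.suc m} t u = begin
    + length (filter P? (row ++ rest))                               ≡⟨ cong (+_ ∘ length) (filter-++ P? row rest) ⟩
    + length (filter P? row ++ filter P? rest)                       ≡⟨ cong +_ (length-++ (filter P? row)) ⟩
    + (length (filter P? row) ℕ.+ length (filter P? rest))           ≡⟨ ℤ.pos-+ (length (filter P? row)) (length (filter P? rest)) ⟩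
    + length (filter P? row) + + length (filter P? rest)             ≡⟨ cong₂ _+_ row-count (count-cartesianProduct (t ∘ suc) u) ⟩
    ∑[ j < _ ] 𝟙 (P? (t zero , u j)) + ∑[ i < m ] ∑[ j < _ ] 𝟙 (P? (t (suc i) , u j)) ∎
    where
    row rest : List (A × B)
    row = map (t zero ,_) (tabulate u)
    rest = cartesianProduct (tabulate (t ∘ suc)) (tabulate u)
    row-count : + length (filter P? row) ≡ ∑[ j < _ ] 𝟙 (P? (t zero , u j))
    row-count = trans (cong (+_ ∘ length ∘ filter P?) (map-tabulate u (t zero ,_))) (count-tabulate P? ((t zero ,_) ∘ u))

-- The integral group ring of an abelian group on Fin n

module GroupRing {n : ℕ} {mul : Op₂ (Fin n)} {unit : Fin n} {inv : Op₁ (Fin n)}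
                 (isAbelianGroup : Structures.IsAbelianGroup _≡_ mul unit inv) where

  private
    abelianGroup : AbelianGroup 0ℓ 0ℓ
    abelianGroup = record { isAbelianGroup = isAbelianGroup }

  open AbelianGroup abelianGroup using (_∙_; ε; _⁻¹; assoc; comm; identityʳ; inverseˡ)
  open import Algebra.Properties.AbelianGroup abelianGroup
    using (⁻¹-involutive; ⁻¹-anti-homo-∙; ⁻¹-anti-homo-\\; \\-leftDividesˡ; \\-leftDividesʳ; ⁻¹-∙-comm; ε⁻¹≈ε; ⁻¹-injective)

  x⁻¹∙a-involutive : ∀ a x → (x ⁻¹ ∙ a) ⁻¹ ∙ a ≡ x
  x⁻¹∙a-involutive a x = trans (cong (_∙ a) (⁻¹-anti-homo-\\ x a)) (trans (comm _ a) (\\-leftDividesˡ a x))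

  [x∙y]⁻¹∙a≡y⁻¹∙[x⁻¹∙a] : ∀ x y a → (x ∙ y) ⁻¹ ∙ a ≡ y ⁻¹ ∙ (x ⁻¹ ∙ a)
  [x∙y]⁻¹∙a≡y⁻¹∙[x⁻¹∙a] x y a = begin
    (x ∙ y) ⁻¹ ∙ a     ≡⟨ cong (_∙ a) (⁻¹-anti-homo-∙ x y) ⟩
    y ⁻¹ ∙ x ⁻¹ ∙ a    ≡⟨ assoc (y ⁻¹) (x ⁻¹) a ⟩
    y ⁻¹ ∙ (x ⁻¹ ∙ a)  ∎

  ℤ[G] : Set
  ℤ[G] = Fin n → ℤ

  infixl 7 _⋆_
  infixr 8 _·_
  infixl 6 _⊕_ _⊖_
  infix 10 _†

  _⋆_ : ℤ[G] → ℤ[G] → ℤ[G]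
  (F ⋆ H) a = ∑[ x < n ] (F x * H (x ⁻¹ ∙ a))

  _† : ℤ[G] → ℤ[G]
  (F †) x = F (x ⁻¹)

  _⊕_ _⊖_ : ℤ[G] → ℤ[G] → ℤ[G]
  (F ⊕ H) x = F x + H x
  (F ⊖ H) x = F x - H x

  _·_ : ℤ → ℤ[G] → ℤ[G]
  (c · F) x = c * F x

  𝟏 δ : ℤ[G]
  𝟏 _ = 1ℤ
  δ x = 𝟙 (x ≟ ε)

  ∑-† : ∀ F → sum (F †) ≡ sum F
  ∑-† F = sym (∑-reindex F _⁻¹ _⁻¹ ⁻¹-involutive ⁻¹-involutive)

  ††-involutive : ∀ F → F † † ≗ F
  ††-involutive F x = cong F (⁻¹-involutive x)

  δ-† : δ † ≗ δ
  δ-† x = 𝟙-cong (mk⇔ (λ x⁻¹≡ε → ⁻¹-injective (trans x⁻¹≡ε (sym ε⁻¹≈ε))) (λ x≡ε → trans (cong _⁻¹ x≡ε) ε⁻¹≈ε))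
                 (x ⁻¹ ≟ ε) (x ≟ ε)

  ⋆-congˡ : ∀ F {H H′} → H ≗ H′ → F ⋆ H ≗ F ⋆ H′
  ⋆-congˡ F H≗H′ a = sum-cong-≗ (λ x → cong (F x *_) (H≗H′ (x ⁻¹ ∙ a)))

  ⋆-congʳ : ∀ {F F′} H → F ≗ F′ → F ⋆ H ≗ F′ ⋆ H
  ⋆-congʳ H F≗F′ a = sum-cong-≗ (λ x → cong (_* H (x ⁻¹ ∙ a)) (F≗F′ x))

  ⋆-comm : ∀ F H → F ⋆ H ≗ H ⋆ F
  ⋆-comm F H a = begin
    ∑[ x < n ] (F x * H (x ⁻¹ ∙ a))                              ≡⟨ ∑-reindex (λ x → F x * H (x ⁻¹ ∙ a)) φ φ φ-involutive φ-involutive ⟩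
    ∑[ x < n ] (F (x ⁻¹ ∙ a) * H ((x ⁻¹ ∙ a) ⁻¹ ∙ a))          ≡⟨ sum-cong-≗ (λ x → cong (F (x ⁻¹ ∙ a) *_) (cong H (φ-involutive x))) ⟩
    ∑[ x < n ] (F (x ⁻¹ ∙ a) * H x)                              ≡⟨ sum-cong-≗ (λ x → ℤ.*-comm (F (x ⁻¹ ∙ a)) (H x)) ⟩
    ∑[ x < n ] (H x * F (x ⁻¹ ∙ a))                              ∎
    where
    φ : Fin n → Fin n
    φ x = x ⁻¹ ∙ a
    φ-involutive : ∀ x → φ (φ x) ≡ x
    φ-involutive = x⁻¹∙a-involutive a

  ⋆-assoc : ∀ F H K → (F ⋆ H) ⋆ K ≗ F ⋆ (H ⋆ K)
  ⋆-assoc F H K a = begin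
    ∑[ y < n ] (∑[ x < n ] (F x * H (x ⁻¹ ∙ y)) * K (y ⁻¹ ∙ a))
      ≡⟨ sum-cong-≗ (λ y → *-distribʳ-sum (K (y ⁻¹ ∙ a)) (λ x → F x * H (x ⁻¹ ∙ y))) ⟩
    ∑[ y < n ] ∑[ x < n ] (F x * H (x ⁻¹ ∙ y) * K (y ⁻¹ ∙ a))
      ≡⟨ ∑-comm (λ y x → F x * H (x ⁻¹ ∙ y) * K (y ⁻¹ ∙ a)) ⟩
    ∑[ x < n ] ∑[ y < n ] (F x * H (x ⁻¹ ∙ y) * K (y ⁻¹ ∙ a))
      ≡⟨ sum-cong-≗ (λ x → sum-cong-≗ {n} (λ y → ℤ.*-assoc (F x) (H (x ⁻¹ ∙ y)) (K (y ⁻¹ ∙ a)))) ⟩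
    ∑[ x < n ] ∑[ y < n ] (F x * (H (x ⁻¹ ∙ y) * K (y ⁻¹ ∙ a)))
      ≡⟨ sum-cong-≗ (λ x → sym (*-distribˡ-sum (F x) (λ y → H (x ⁻¹ ∙ y) * K (y ⁻¹ ∙ a)))) ⟩
    ∑[ x < n ] (F x * ∑[ y < n ] (H (x ⁻¹ ∙ y) * K (y ⁻¹ ∙ a)))
      ≡⟨ sum-cong-≗ (λ x → cong (F x *_) (translate x)) ⟩
    ∑[ x < n ] (F x * (H ⋆ K) (x ⁻¹ ∙ a)) ∎
    where
    translate : ∀ x → ∑[ y < n ] (H (x ⁻¹ ∙ y) * K (y ⁻¹ ∙ a)) ≡ (H ⋆ K) (x ⁻¹ ∙ a)
    translate x = trans (∑-reindex (λ y → H (x ⁻¹ ∙ y) * K (y ⁻¹ ∙ a)) (x ∙_) (x ⁻¹ ∙_) (\\-leftDividesˡ x) (\\-leftDividesʳ x))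
      (sum-cong-≗ (λ z → cong₂ (λ u w → H u * K w) (\\-leftDividesʳ x z) ([x∙y]⁻¹∙a≡y⁻¹∙[x⁻¹∙a] x z a)))

  ⋆-interchange : ∀ F H K L → (F ⋆ H) ⋆ (K ⋆ L) ≗ (F ⋆ K) ⋆ (H ⋆ L)
  ⋆-interchange F H K L a = begin
    ((F ⋆ H) ⋆ (K ⋆ L)) a    ≡⟨ ⋆-assoc F H (K ⋆ L) a ⟩
    (F ⋆ (H ⋆ (K ⋆ L))) a    ≡⟨ ⋆-congˡ F (λ b → sym (⋆-assoc H K L b)) a ⟩
    (F ⋆ ((H ⋆ K) ⋆ L)) a    ≡⟨ ⋆-congˡ F (⋆-congʳ L (⋆-comm H K)) a ⟩
    (F ⋆ ((K ⋆ H) ⋆ L)) a    ≡⟨ ⋆-congˡ F (⋆-assoc K H L) a ⟩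
    (F ⋆ (K ⋆ (H ⋆ L))) a    ≡⟨ sym (⋆-assoc F K (H ⋆ L) a) ⟩
    ((F ⋆ K) ⋆ (H ⋆ L)) a    ∎

  ⋆-distribˡ-⊕ : ∀ F H K → F ⋆ (H ⊕ K) ≗ F ⋆ H ⊕ F ⋆ K
  ⋆-distribˡ-⊕ F H K a =
    trans (sum-cong-≗ (λ x → ℤ.*-distribˡ-+ (F x) (H (x ⁻¹ ∙ a)) (K (x ⁻¹ ∙ a))))
          (∑-distrib-+ (λ x → F x * H (x ⁻¹ ∙ a)) (λ x → F x * K (x ⁻¹ ∙ a)))

  ⋆-distribˡ-⊖ : ∀ F H K → F ⋆ (H ⊖ K) ≗ F ⋆ H ⊖ F ⋆ K
  ⋆-distribˡ-⊖ F H K a =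
    trans (sum-cong-≗ (λ x → *-distribˡ-- (F x) (H (x ⁻¹ ∙ a)) (K (x ⁻¹ ∙ a))))
          (∑-distrib-- (λ x → F x * H (x ⁻¹ ∙ a)) (λ x → F x * K (x ⁻¹ ∙ a)))
    where
    *-distribˡ-- : ∀ i j k → i * (j - k) ≡ i * j - i * k
    *-distribˡ-- = solve-∀

  ⋆-· : ∀ F c H → F ⋆ (c · H) ≗ c · (F ⋆ H)
  ⋆-· F c H a =
    trans (sum-cong-≗ (λ x → *-comm-middle (F x) c (H (x ⁻¹ ∙ a))))
          (sym (*-distribˡ-sum c (λ x → F x * H (x ⁻¹ ∙ a))))
    where
    *-comm-middle : ∀ i j k → i * (j * k) ≡ j * (i * k)
    *-comm-middle = solve-∀

  ⋆-𝟏 : ∀ F a → (F ⋆ 𝟏) a ≡ sum F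
  ⋆-𝟏 F a = sum-cong-≗ (λ x → ℤ.*-identityʳ (F x))

  ⋆-δ : ∀ F → F ⋆ δ ≗ F
  ⋆-δ F a = trans (sum-cong-≗ (λ x → cong (F x *_) (𝟙-cong (x⁻¹∙a≡ε⇔x≡a x) (x ⁻¹ ∙ a ≟ ε) (x ≟ a))))
                  (∑-dirac F a)
    where
    x⁻¹∙a≡ε⇔x≡a : ∀ x → x ⁻¹ ∙ a ≡ ε ⇔ x ≡ a
    x⁻¹∙a≡ε⇔x≡a x = mk⇔
      (λ x⁻¹∙a≡ε → trans (sym (identityʳ x)) (trans (cong (x ∙_) (sym x⁻¹∙a≡ε)) (\\-leftDividesˡ x a)))
      (λ { refl → inverseˡ a })

  ⋆-at-ε : ∀ F H → (F ⋆ H) ε ≡ ∑[ x < n ] (F x * H (x ⁻¹))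
  ⋆-at-ε F H = sum-cong-≗ (λ x → cong (λ y → F x * H y) (identityʳ (x ⁻¹)))

  †-⋆ : ∀ F H → (F ⋆ H) † ≗ F † ⋆ H †
  †-⋆ F H a = trans (∑-reindex (λ x → F x * H (x ⁻¹ ∙ a ⁻¹)) _⁻¹ _⁻¹ ⁻¹-involutive ⁻¹-involutive)
                    (sum-cong-≗ (λ x → cong (λ y → F (x ⁻¹) * H y) (⁻¹-∙-comm (x ⁻¹) a)))

  module ConstantOffIdentity (f : ℤ[G]) (μ : ℤ) (f⋆f-const : ∀ a → a ≢ ε → (f ⋆ f) a ≡ μ) where

    c : ℤ
    c = (f ⋆ f) ε - μ

    f⋆f≗μ·𝟏⊕c·δ : f ⋆ f ≗ μ · 𝟏 ⊕ c · δ
    f⋆f≗μ·𝟏⊕c·δ a with a ≟ ε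
    ... | yes refl = p≡m*1+[p-m]*1 ((f ⋆ f) ε) μ
      where
      p≡m*1+[p-m]*1 : ∀ p m → p ≡ m * 1ℤ + (p - m) * 1ℤ
      p≡m*1+[p-m]*1 = solve-∀
    ... | no a≢ε = trans (f⋆f-const a a≢ε) (m≡m*1+k*0 μ c)
      where
      m≡m*1+k*0 : ∀ m k → m ≡ m * 1ℤ + k * 0ℤ
      m≡m*1+k*0 = solve-∀

    ⋆-f⋆f : ∀ X → sum X ≡ 0ℤ → X ⋆ (f ⋆ f) ≗ c · X
    ⋆-f⋆f X ∑X≡0 a = begin
      (X ⋆ (f ⋆ f)) a                       ≡⟨ ⋆-congˡ X f⋆f≗μ·𝟏⊕c·δ a ⟩
      (X ⋆ (μ · 𝟏 ⊕ c · δ)) a               ≡⟨ ⋆-distribˡ-⊕ X (μ · 𝟏) (c · δ) a ⟩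
      (X ⋆ μ · 𝟏) a + (X ⋆ c · δ) a         ≡⟨ cong₂ _+_ (⋆-· X μ 𝟏 a) (⋆-· X c δ a) ⟩
      μ * (X ⋆ 𝟏) a + c * (X ⋆ δ) a         ≡⟨ cong₂ (λ u w → μ * u + c * w) (trans (⋆-𝟏 X a) ∑X≡0) (⋆-δ X a) ⟩
      μ * 0ℤ + c * X a                      ≡⟨ m*0+y≡y μ (c * X a) ⟩
      c * X a                               ∎
      where
      m*0+y≡y : ∀ m y → m * 0ℤ + y ≡ y
      m*0+y≡y = solve-∀

    f⋆f-self-adjoint : (f ⋆ f) † ≗ f ⋆ f
    f⋆f-self-adjoint a = begin
      (f ⋆ f) (a ⁻¹)             ≡⟨ f⋆f≗μ·𝟏⊕c·δ (a ⁻¹) ⟩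
      μ * 1ℤ + c * δ (a ⁻¹)      ≡⟨ cong (λ d → μ * 1ℤ + c * d) (δ-† a) ⟩
      μ * 1ℤ + c * δ a           ≡⟨ sym (f⋆f≗μ·𝟏⊕c·δ a) ⟩
      (f ⋆ f) a                  ∎

    f†⋆f†≗f⋆f : f † ⋆ f † ≗ f ⋆ f
    f†⋆f†≗f⋆f a = trans (sym (†-⋆ f f a)) (f⋆f-self-adjoint a)

    ∑-sq-f⋆ : ∀ X → sum X ≡ 0ℤ → (f ⋆ X) † ≗ f ⋆ X → ∑[ x < n ] ((f ⋆ X) x * (f ⋆ X) x) ≡ c * (X ⋆ X) ε
    ∑-sq-f⋆ X ∑X≡0 W-self-adjoint = begin
      ∑[ x < n ] (W x * W x)            ≡⟨ sum-cong-≗ (λ x → cong (W x *_) (sym (W-self-adjoint x))) ⟩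
      ∑[ x < n ] (W x * W (x ⁻¹))       ≡⟨ sym (⋆-at-ε W W) ⟩
      ((f ⋆ X) ⋆ (f ⋆ X)) ε             ≡⟨ ⋆-interchange f X f X ε ⟩
      ((f ⋆ f) ⋆ (X ⋆ X)) ε             ≡⟨ ⋆-comm (f ⋆ f) (X ⋆ X) ε ⟩
      ((X ⋆ X) ⋆ (f ⋆ f)) ε             ≡⟨ ⋆-assoc X X (f ⋆ f) ε ⟩
      (X ⋆ (X ⋆ (f ⋆ f))) ε             ≡⟨ ⋆-congˡ X (⋆-f⋆f X ∑X≡0) ε ⟩
      (X ⋆ c · X) ε                     ≡⟨ ⋆-· X c X ε ⟩
      c * (X ⋆ X) ε                     ∎
      where
      W : ℤ[G]
      W = f ⋆ X

    h : ℤ[G]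
    h = f ⊖ f †

    ∑h≡0 : sum h ≡ 0ℤ
    ∑h≡0 = trans (∑-distrib-- f (f †)) (trans (cong (λ t → sum f - t) (∑-† f)) (ℤ.+-inverseʳ (sum f)))

    h†≡-h : ∀ x → h (x ⁻¹) ≡ - h x
    h†≡-h x = trans (cong (λ t → f (x ⁻¹) - t) (††-involutive f x)) (i-j≡-[j-i] (f (x ⁻¹)) (f x))
      where
      i-j≡-[j-i] : ∀ i j → i - j ≡ - (j - i)
      i-j≡-[j-i] = solve-∀

    f⋆h-self-adjoint : (f ⋆ h) † ≗ f ⋆ h
    f⋆h-self-adjoint x = begin
      (f ⋆ h) (x ⁻¹)                          ≡⟨ ⋆-distribˡ-⊖ f f (f †) (x ⁻¹) ⟩
      (f ⋆ f) (x ⁻¹) - (f ⋆ f †) (x ⁻¹)       ≡⟨ cong₂ _-_ (f⋆f-self-adjoint x) f⋆f†-self-adjoint ⟩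
      (f ⋆ f) x - (f ⋆ f †) x                 ≡⟨ sym (⋆-distribˡ-⊖ f f (f †) x) ⟩
      (f ⋆ h) x                               ∎
      where
      f⋆f†-self-adjoint : (f ⋆ f †) (x ⁻¹) ≡ (f ⋆ f †) x
      f⋆f†-self-adjoint = begin
        (f ⋆ f †) (x ⁻¹)     ≡⟨ †-⋆ f (f †) x ⟩
        (f † ⋆ f † †) x      ≡⟨ ⋆-congˡ (f †) (††-involutive f) x ⟩
        (f † ⋆ f) x          ≡⟨ ⋆-comm (f †) f x ⟩
        (f ⋆ f †) x          ∎

    h⋆h[ε]≡-∑h² : (h ⋆ h) ε ≡ - ∑[ x < n ] (h x * h x)
    h⋆h[ε]≡-∑h² = begin
      (h ⋆ h) ε                      ≡⟨ ⋆-at-ε h h ⟩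
      ∑[ x < n ] (h x * h (x ⁻¹))    ≡⟨ sum-cong-≗ (λ x → trans (cong (h x *_) (h†≡-h x)) (sym (ℤ.neg-distribʳ-* (h x) (h x)))) ⟩
      ∑[ x < n ] (- (h x * h x))     ≡⟨ ∑-neg (λ x → h x * h x) ⟩
      - ∑[ x < n ] (h x * h x)       ∎

    ∑h²≡-2[f⋆h][ε] : ∑[ x < n ] (h x * h x) ≡ - ((f ⋆ h) ε + (f ⋆ h) ε)
    ∑h²≡-2[f⋆h][ε] = begin
      ∑[ x < n ] (h x * h x)                                  ≡⟨ sum-cong-≗ (λ x → *-distribˡ-- (h x) (f x) (f (x ⁻¹))) ⟩
      ∑[ x < n ] (h x * f x - h x * f (x ⁻¹))                 ≡⟨ ∑-distrib-- (λ x → h x * f x) (λ x → h x * f (x ⁻¹)) ⟩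
      ∑[ x < n ] (h x * f x) - ∑[ x < n ] (h x * f (x ⁻¹))    ≡⟨ cong (_- ∑[ x < n ] (h x * f (x ⁻¹))) ⟨h,f⟩≡-⟨h,f†⟩ ⟩
      - A - A                                                 ≡⟨ cong (λ t → - t - t) ⟨h,f†⟩≡[f⋆h][ε] ⟩
      - (f ⋆ h) ε - (f ⋆ h) ε                                 ≡⟨ -i-i≡-[i+i] ((f ⋆ h) ε) ⟩
      - ((f ⋆ h) ε + (f ⋆ h) ε)                               ∎
      where
      A : ℤ
      A = ∑[ x < n ] (h x * f (x ⁻¹))
      *-distribˡ-- : ∀ i j k → i * (j - k) ≡ i * j - i * k
      *-distribˡ-- = solve-∀
      -i-i≡-[i+i] : ∀ i → - i - i ≡ - (i + i)
      -i-i≡-[i+i] = solve-∀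
      ⟨h,f†⟩≡[f⋆h][ε] : A ≡ (f ⋆ h) ε
      ⟨h,f†⟩≡[f⋆h][ε] = trans (sym (⋆-at-ε h f)) (⋆-comm h f ε)
      ⟨h,f⟩≡-⟨h,f†⟩ : ∑[ x < n ] (h x * f x) ≡ - A
      ⟨h,f⟩≡-⟨h,f†⟩ = begin
        ∑[ x < n ] (h x * f x)                 ≡⟨ ∑-reindex (λ x → h x * f x) _⁻¹ _⁻¹ ⁻¹-involutive ⁻¹-involutive ⟩
        ∑[ x < n ] (h (x ⁻¹) * f (x ⁻¹))       ≡⟨ sum-cong-≗ (λ x → trans (cong (_* f (x ⁻¹)) (h†≡-h x)) (sym (ℤ.neg-distribˡ-* (h x) (f (x ⁻¹))))) ⟩
        ∑[ x < n ] (- (h x * f (x ⁻¹)))        ≡⟨ ∑-neg (λ x → h x * f (x ⁻¹)) ⟩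
        - A                                    ∎

    f†≗f-if-c≥0 : ∀ m → c ≡ + m → f † ≗ f
    f†≗f-if-c≥0 m c≡+m x = sym (ℤ.i-j≡0⇒i≡j (f x) (f (x ⁻¹)) (h≗0 x))
      where
      ‖f⋆h‖²≡ : + ‖ f ⋆ h ‖² ≡ + m * - + ‖ h ‖²
      ‖f⋆h‖²≡ = begin
        + ‖ f ⋆ h ‖²                             ≡⟨ sym (∑-sq≡‖‖² (f ⋆ h)) ⟩
        ∑[ x < n ] ((f ⋆ h) x * (f ⋆ h) x)       ≡⟨ ∑-sq-f⋆ h ∑h≡0 f⋆h-self-adjoint ⟩
        c * (h ⋆ h) ε                            ≡⟨ cong₂ _*_ c≡+m (trans h⋆h[ε]≡-∑h² (cong -_ (∑-sq≡‖‖² h))) ⟩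
        + m * - + ‖ h ‖²                         ∎
      f⋆h≗0 : ∀ x → (f ⋆ h) x ≡ 0ℤ
      f⋆h≗0 = ‖‖²≡0⇒≡0 (f ⋆ h) (+m≡+n*-+k⇒m≡0 _ m _ ‖f⋆h‖²≡)
      ‖h‖²≡0 : ‖ h ‖² ≡ 0
      ‖h‖²≡0 = ℤ.+-injective (begin
        + ‖ h ‖²                        ≡⟨ sym (∑-sq≡‖‖² h) ⟩
        ∑[ x < n ] (h x * h x)          ≡⟨ ∑h²≡-2[f⋆h][ε] ⟩
        - ((f ⋆ h) ε + (f ⋆ h) ε)       ≡⟨ cong (λ t → - (t + t)) (f⋆h≗0 ε) ⟩
        0ℤ                              ∎)
      h≗0 : ∀ x → h x ≡ 0ℤ
      h≗0 = ‖‖²≡0⇒≡0 h ‖h‖²≡0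

    s T : ℤ[G]
    s = f ⊕ f †
    T = (+ n) · s ⊖ (sum f + sum f) · 𝟏

    ∑T≡0 : sum T ≡ 0ℤ
    ∑T≡0 = begin
      sum T                                                   ≡⟨ ∑-distrib-- ((+ n) · s) ((K + K) · 𝟏) ⟩
      sum ((+ n) · s) - ∑[ x < n ] ((K + K) * 1ℤ)               ≡⟨ cong₂ _-_ (sym (*-distribˡ-sum (+ n) s)) (∑-const n ((K + K) * 1ℤ)) ⟩
      + n * sum s - + n * ((K + K) * 1ℤ)                      ≡⟨ cong (λ t → + n * t - + n * ((K + K) * 1ℤ)) ∑s≡K+K ⟩
      + n * (K + K) - + n * ((K + K) * 1ℤ)                    ≡⟨ i*j-i*[j*1]≡0 (+ n) (K + K) ⟩
      0ℤ                                                      ∎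
      where
      K : ℤ
      K = sum f
      ∑s≡K+K : sum s ≡ K + K
      ∑s≡K+K = trans (∑-distrib-+ f (f †)) (cong (λ t → K + t) (∑-† f))
      i*j-i*[j*1]≡0 : ∀ i j → i * j - i * (j * 1ℤ) ≡ 0ℤ
      i*j-i*[j*1]≡0 = solve-∀

    T-self-adjoint : T † ≗ T
    T-self-adjoint x = cong (λ t → + n * t - (sum f + sum f) * 1ℤ)
      (trans (cong (λ t → f (x ⁻¹) + t) (††-involutive f x)) (ℤ.+-comm (f (x ⁻¹)) (f x)))

    f⋆s≗f†⋆s : f ⋆ s ≗ f † ⋆ s
    f⋆s≗f†⋆s a = begin
      (f ⋆ s) a                        ≡⟨ ⋆-distribˡ-⊕ f f (f †) a ⟩
      (f ⋆ f) a + (f ⋆ f †) a          ≡⟨ cong₂ _+_ (sym (f†⋆f†≗f⋆f a)) (⋆-comm f (f †) a) ⟩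
      (f † ⋆ f †) a + (f † ⋆ f) a      ≡⟨ ℤ.+-comm ((f † ⋆ f †) a) ((f † ⋆ f) a) ⟩
      (f † ⋆ f) a + (f † ⋆ f †) a      ≡⟨ sym (⋆-distribˡ-⊕ (f †) f (f †) a) ⟩
      (f † ⋆ s) a                      ∎

    ⋆-T : ∀ F a → (F ⋆ T) a ≡ + n * (F ⋆ s) a - (sum f + sum f) * sum F
    ⋆-T F a = begin
      (F ⋆ T) a                                                    ≡⟨ ⋆-distribˡ-⊖ F ((+ n) · s) ((sum f + sum f) · 𝟏) a ⟩
      (F ⋆ (+ n) · s) a - (F ⋆ (sum f + sum f) · 𝟏) a                ≡⟨ cong₂ _-_ (⋆-· F (+ n) s a) (⋆-· F (sum f + sum f) 𝟏 a) ⟩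
      + n * (F ⋆ s) a - (sum f + sum f) * (F ⋆ 𝟏) a                ≡⟨ cong (λ t → + n * (F ⋆ s) a - (sum f + sum f) * t) (⋆-𝟏 F a) ⟩
      + n * (F ⋆ s) a - (sum f + sum f) * sum F                    ∎

    f⋆T-self-adjoint : (f ⋆ T) † ≗ f ⋆ T
    f⋆T-self-adjoint a = begin
      (f ⋆ T) (a ⁻¹)        ≡⟨ †-⋆ f T a ⟩
      (f † ⋆ T †) a         ≡⟨ ⋆-congˡ (f †) T-self-adjoint a ⟩
      (f † ⋆ T) a           ≡⟨ ⋆-T (f †) a ⟩
      + n * (f † ⋆ s) a - (sum f + sum f) * sum (f †)
                            ≡⟨ cong₂ (λ u w → + n * u - (sum f + sum f) * w) (sym (f⋆s≗f†⋆s a)) (∑-† f) ⟩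
      + n * (f ⋆ s) a - (sum f + sum f) * sum f
                            ≡⟨ sym (⋆-T f a) ⟩
      (f ⋆ T) a             ∎

    f+f†-const-if-c<0 : ∀ m → c ≡ -[1+ m ] → ∀ x → f x + f (x ⁻¹) ≡ f ε + f ε
    f+f†-const-if-c<0 m c≡-[1+m] x =
      trans (+n*-cancel ε (s x) (s ε) (trans (n*s≡2K x) (sym (n*s≡2K ε)))) (cong (λ t → f ε + f t) ε⁻¹≈ε)
      where
      ‖f⋆T‖²≡ : + ‖ f ⋆ T ‖² ≡ -[1+ m ] * + ‖ T ‖²
      ‖f⋆T‖²≡ = begin
        + ‖ f ⋆ T ‖²                             ≡⟨ sym (∑-sq≡‖‖² (f ⋆ T)) ⟩
        ∑[ x < n ] ((f ⋆ T) x * (f ⋆ T) x)       ≡⟨ ∑-sq-f⋆ T ∑T≡0 f⋆T-self-adjoint ⟩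
        c * (T ⋆ T) ε                            ≡⟨ cong₂ _*_ c≡-[1+m] T⋆T[ε]≡‖T‖² ⟩
        -[1+ m ] * + ‖ T ‖²                      ∎
        where
        T⋆T[ε]≡‖T‖² : (T ⋆ T) ε ≡ + ‖ T ‖²
        T⋆T[ε]≡‖T‖² = trans (⋆-at-ε T T) (trans (sum-cong-≗ (λ x → cong (T x *_) (T-self-adjoint x))) (∑-sq≡‖‖² T))
      T≗0 : ∀ x → T x ≡ 0ℤ
      T≗0 = ‖‖²≡0⇒≡0 T (+m≡-[1+n]*+k⇒k≡0 _ m _ ‖f⋆T‖²≡)
      n*s≡2K : ∀ x → + n * s x ≡ (sum f + sum f) * 1ℤ
      n*s≡2K x = ℤ.i-j≡0⇒i≡j _ _ (T≗0 x)

    f†≗f⊎f+f†-const : f † ≗ f ⊎ (∀ x → f x + f (x ⁻¹) ≡ f ε + f ε)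
    f†≗f⊎f+f†-const = by-sign c refl
      where
      by-sign : ∀ d → c ≡ d → f † ≗ f ⊎ (∀ x → f x + f (x ⁻¹) ≡ f ε + f ε)
      by-sign (+ m) c≡+m = inj₁ (f†≗f-if-c≥0 m c≡+m)
      by-sign -[1+ m ] c≡-[1+m] = inj₂ (f+f†-const-if-c<0 m c≡-[1+m])

-- Transporting the group structure along enum makes equality propositional, so that
-- elements of ℤ[G] are plain functions Fin v → ℤ with no congruence obligations.
module FinEnumeration {v : ℕ} (G : FiniteAbelianGroup v) where

  open FiniteAbelianGroup G
    using (Carrier; _≈_; _∙_; ε; _⁻¹; setoid; ∙-cong; assoc; comm; identityˡ; identityʳ; inverseˡ; inverseʳ;
           enum; enum-injective; enum-surjective)
  private module ≈ = Setoid setoid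

  idx : Carrier → Fin v
  idx x = proj₁ (enum-surjective x)

  enum-idx : ∀ x → enum (idx x) ≈ x
  enum-idx x = proj₂ (enum-surjective x)

  idx-unique : ∀ {x i} → x ≈ enum i → idx x ≡ i
  idx-unique x≈i = enum-injective (≈.trans (enum-idx _) x≈i)

  idx-cong : ∀ {x y} → x ≈ y → idx x ≡ idx y
  idx-cong {y = y} x≈y = idx-unique (≈.trans x≈y (≈.sym (enum-idx y)))

  infixl 7 _∙ᶠ_
  infix 8 _⁻¹ᶠ

  _∙ᶠ_ : Op₂ (Fin v)
  i ∙ᶠ j = idx (enum i ∙ enum j)

  εᶠ : Fin v
  εᶠ = idx ε

  _⁻¹ᶠ : Op₁ (Fin v)
  i ⁻¹ᶠ = idx (enum i ⁻¹)

  isAbelianGroup : Structures.IsAbelianGroup _≡_ _∙ᶠ_ εᶠ _⁻¹ᶠ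
  isAbelianGroup = record
    { isGroup = record
      { isMonoid = record
        { isSemigroup = record
          { isMagma = record { isEquivalence = isEquivalence ; ∙-cong = cong₂ _∙ᶠ_ }
          ; assoc = λ i j k → idx-cong (≈.trans (∙-cong (enum-idx _) ≈.refl)
                                      (≈.trans (assoc _ _ _) (∙-cong ≈.refl (≈.sym (enum-idx _))))) }
        ; identity = (λ i → idx-unique (≈.trans (∙-cong (enum-idx ε) ≈.refl) (identityˡ (enum i))))
                   , (λ i → idx-unique (≈.trans (∙-cong ≈.refl (enum-idx ε)) (identityʳ (enum i)))) }
      ; inverse = (λ i → idx-cong (≈.trans (∙-cong (enum-idx _) ≈.refl) (inverseˡ (enum i))))
                , (λ i → idx-cong (≈.trans (∙-cong ≈.refl (enum-idx _)) (inverseʳ (enum i))))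
      ; ⁻¹-cong = cong _⁻¹ᶠ }
    ; comm = λ i j → idx-cong (comm (enum i) (enum j)) }

module SumSetIndicator {v : ℕ} (G : FiniteAbelianGroup v) (S : Subset G) where

  open FiniteAbelianGroup G
    using (_≈_; _∙_; ε; _⁻¹; setoid; ∙-cong; ⁻¹-cong; abGroup; enum; enum-injective)
    renaming (_≟_ to _≟ᴳ_)
  open import Algebra.Properties.AbelianGroup abGroup using (\\-leftDividesˡ; y≈x\\z)
  open FinEnumeration G
  open GroupRing isAbelianGroup using (ℤ[G]; _⋆_; _†; module ConstantOffIdentity)
  private module ≈ = Setoid setoid

  S? : ∀ x → Dec (_∈S S x)
  S? = _∈S? S

  𝟙S : ℤ[G]
  𝟙S i = 𝟙 (S? (enum i))

  𝟙S-idx : ∀ x → 𝟙S (idx x) ≡ 𝟙 (S? x)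
  𝟙S-idx x = 𝟙-cong (mk⇔ (respects S (enum-idx x)) (respects S (≈.sym (enum-idx x)))) (S? (enum (idx x))) (S? x)

  enum-∙≈⇔ : ∀ a i j → enum i ∙ enum j ≈ a ⇔ j ≡ i ⁻¹ᶠ ∙ᶠ idx a
  enum-∙≈⇔ a i j = mk⇔
    (λ i∙j≈a → sym (enum-injective (≈.trans enum-[i⁻¹∙a] (≈.sym (y≈x\\z (enum i) (enum j) a i∙j≈a)))))
    (λ { refl → ≈.trans (∙-cong ≈.refl enum-[i⁻¹∙a]) (\\-leftDividesˡ (enum i) a) })
    where
    enum-[i⁻¹∙a] : enum (i ⁻¹ᶠ ∙ᶠ idx a) ≈ enum i ⁻¹ ∙ a
    enum-[i⁻¹∙a] = ≈.trans (enum-idx _) (∙-cong (enum-idx _) (enum-idx a))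

  reps≡𝟙S⋆𝟙S : ∀ a → + reps G S a ≡ (𝟙S ⋆ 𝟙S) (idx a)
  reps≡𝟙S⋆𝟙S a = begin
    + reps G S a
      ≡⟨ count-cartesianProduct Pair? (λ i → i) (λ j → j) ⟩
    ∑[ i < v ] ∑[ j < v ] 𝟙 (Pair? (i , j))
      ≡⟨ sum-cong-≗ (λ i → sum-cong-≗ (pair-indicator i)) ⟩
    ∑[ i < v ] ∑[ j < v ] (𝟙S i * (𝟙S j * 𝟙 (j ≟ i ⁻¹ᶠ ∙ᶠ idx a)))
      ≡⟨ sum-cong-≗ (λ i → sym (*-distribˡ-sum (𝟙S i) (λ j → 𝟙S j * 𝟙 (j ≟ i ⁻¹ᶠ ∙ᶠ idx a)))) ⟩
    ∑[ i < v ] (𝟙S i * ∑[ j < v ] (𝟙S j * 𝟙 (j ≟ i ⁻¹ᶠ ∙ᶠ idx a)))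
      ≡⟨ sum-cong-≗ (λ i → cong (𝟙S i *_) (∑-dirac 𝟙S (i ⁻¹ᶠ ∙ᶠ idx a))) ⟩
    ∑[ i < v ] (𝟙S i * 𝟙S (i ⁻¹ᶠ ∙ᶠ idx a)) ∎
    where
    Pair? : ∀ p → Dec _
    Pair? (i , j) = (S? (enum i) ×-dec S? (enum j)) ×-dec ((enum i ∙ enum j) ≟ᴳ a)
    pair-indicator : ∀ i j → 𝟙 (Pair? (i , j)) ≡ 𝟙S i * (𝟙S j * 𝟙 (j ≟ i ⁻¹ᶠ ∙ᶠ idx a))
    pair-indicator i j = begin
      𝟙 (Pair? (i , j))
        ≡⟨ 𝟙-×-dec (S? (enum i) ×-dec S? (enum j)) ((enum i ∙ enum j) ≟ᴳ a) ⟩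
      𝟙 (S? (enum i) ×-dec S? (enum j)) * 𝟙 ((enum i ∙ enum j) ≟ᴳ a)
        ≡⟨ cong₂ _*_ (𝟙-×-dec (S? (enum i)) (S? (enum j))) (𝟙-cong (enum-∙≈⇔ a i j) ((enum i ∙ enum j) ≟ᴳ a) (j ≟ i ⁻¹ᶠ ∙ᶠ idx a)) ⟩
      𝟙S i * 𝟙S j * 𝟙 (j ≟ i ⁻¹ᶠ ∙ᶠ idx a)
        ≡⟨ ℤ.*-assoc (𝟙S i) (𝟙S j) _ ⟩
      𝟙S i * (𝟙S j * 𝟙 (j ≟ i ⁻¹ᶠ ∙ᶠ idx a)) ∎

  module _ (μ : ℕ) (reps≡μ : ∀ a → ¬ (a ≈ ε) → reps G S a ≡ μ) where

    𝟙S⋆𝟙S-const : ∀ i → i ≢ εᶠ → (𝟙S ⋆ 𝟙S) i ≡ + μ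
    𝟙S⋆𝟙S-const i i≢ε = begin
      (𝟙S ⋆ 𝟙S) i                 ≡⟨ cong (𝟙S ⋆ 𝟙S) (sym (idx-unique ≈.refl)) ⟩
      (𝟙S ⋆ 𝟙S) (idx (enum i))    ≡⟨ sym (reps≡𝟙S⋆𝟙S (enum i)) ⟩
      + reps G S (enum i)         ≡⟨ cong +_ (reps≡μ (enum i) (λ i≈ε → i≢ε (sym (idx-unique (≈.sym i≈ε))))) ⟩
      + μ                         ∎

    𝟙S-self-adjoint : 𝟙S † ≗ 𝟙S
    𝟙S-self-adjoint with ConstantOffIdentity.f†≗f⊎f+f†-const 𝟙S (+ μ) 𝟙S⋆𝟙S-const
    ... | inj₁ 𝟙S†≗𝟙S = 𝟙S†≗𝟙S
    ... | inj₂ 𝟙S+𝟙S†-const = λ i → sym (𝟙+𝟙≡𝟙+𝟙⇒≡ (S? (enum i)) (S? (enum (i ⁻¹ᶠ))) (S? (enum εᶠ)) (𝟙S+𝟙S†-const i))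

    𝟙[x⁻¹∈S]≡𝟙[x∈S] : ∀ x → 𝟙 (S? (x ⁻¹)) ≡ 𝟙 (S? x)
    𝟙[x⁻¹∈S]≡𝟙[x∈S] x = begin
      𝟙 (S? (x ⁻¹))          ≡⟨ sym (𝟙S-idx (x ⁻¹)) ⟩
      𝟙S (idx (x ⁻¹))        ≡⟨ cong 𝟙S (idx-cong (⁻¹-cong (≈.sym (enum-idx x)))) ⟩
      𝟙S (idx x ⁻¹ᶠ)         ≡⟨ 𝟙S-self-adjoint (idx x) ⟩
      𝟙S (idx x)             ≡⟨ 𝟙S-idx x ⟩
      𝟙 (S? x)               ∎

theorem4p4 : (v : ℕ) (G : FiniteAbelianGroup v) (S : Subset G) (k μ : ℕ) →
    IsSumSet G S k μ → Reversible G S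
theorem4p4 v G S k μ (_ , reps≡μ) x =
  𝟙-≡⇒ (S? x) (S? (x ⁻¹)) (sym 𝟙-inverse) , 𝟙-≡⇒ (S? (x ⁻¹)) (S? x) 𝟙-inverse
  where
  open FiniteAbelianGroup G using (_⁻¹)
  open SumSetIndicator G S
  𝟙-inverse : 𝟙 (S? (x ⁻¹)) ≡ 𝟙 (S? x)
  𝟙-inverse = 𝟙[x⁻¹∈S]≡𝟙[x∈S] μ reps≡μ x
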